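{- Let $q$ be an odd prime power and let $G$ be a graph with $k$ vertices. Then $\widetilde{i}_P(G)\le\lceil\log_3\log_q k\rceil$.
   Context: For a prime power $r\equiv1\pmod 4$, the Paley graph $P(r)$ has vertex set $\mathbb{F}_r$, with $u,v$ adjacent iff $u-v$ is a nonzero square in $\mathbb{F}_r$. For $n\ge1$ let $P_n=P((q^2)^{3^n})$, and let $\widetilde{i}_P(G)=\min\{n\ge1 : G\text{ is a (not necessarily induced) subgraph of }P_n\}$. -}

module Defs where

open import Data.Nat using (ℕ; _^_; _≤_; _%_)
open import Data.Nat.Primality using (Prime)
open import Data.Fin using (Fin)
open import Data.Product using (Σ; ∃; _×_)
open import Relation.Nullary using (¬_)
open import Relation.Binary.PropositionalEquality using (_≡_)
open import Algebra.Structures using (IsCommutativeRing)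
open import Function.Definitions using (Injective)

OddPrimePower : ℕ → Set
OddPrimePower q = Σ ℕ λ p → Σ ℕ λ e → Prime p × p % 2 ≡ 1 × 1 ≤ e × q ≡ p ^ e

record FiniteField (r : ℕ) : Set where
  field
    _+_ _*_ : Fin r → Fin r → Fin r
    -_ : Fin r → Fin r
    0# 1# : Fin r
    isCommutativeRing : IsCommutativeRing _≡_ _+_ _*_ -_ 0# 1#
    0≢1 : ¬ (0# ≡ 1#)
    inverse : ∀ x → ¬ (x ≡ 0#) → ∃ λ y → x * y ≡ 1#

PaleyAdj : ∀ {r} → FiniteField r → Fin r → Fin r → Set
PaleyAdj F u v = ¬ (u - v ≡ 0#) × ∃ λ w → w * w ≡ u - v
  where
  open FiniteField F
  _-_ : Fin _ → Fin _ → Fin _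
  a - b = a + (- b)

record Graph (k : ℕ) : Set₁ where
  field
    Adj : Fin k → Fin k → Set
    sym : ∀ {u v} → Adj u v → Adj v u
    irrefl : ∀ {u} → ¬ Adj u u

-- G is a (not necessarily induced) subgraph of the Paley graph of F:
-- an injective vertex map preserving adjacency.
SubgraphOfPaley : ∀ {k r} → Graph k → FiniteField r → Set
SubgraphOfPaley {k} {r} G F =
  Σ (Fin k → Fin r) λ f → Injective _≡_ _≡_ f ×
    (∀ u v → Graph.Adj G u v → PaleyAdj F (f u) (f v))

-- G is a subgraph of P_n = P((q^2)^(3^n)) (for the, unique up to
-- isomorphism, field of that order; stated for every such field).
SubgraphOfP : ℕ → ℕ → ∀ {k} → Graph k → Set
SubgraphOfP q n G = (F : FiniteField ((q ^ 2) ^ (3 ^ n))) → SubgraphOfPaley G F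

-- ĩ_P(G) ≤ N, i.e. G is a subgraph of P_m for some 1 ≤ m ≤ N.
iP≤ : ℕ → ∀ {k} → Graph k → ℕ → Set
iP≤ q G N = ∃ λ m → 1 ≤ m × m ≤ N × SubgraphOfP q m G

{-# OPTIONS --safe #-}
-- The vertex set of P_N is a field of order r = Q² with Q = q^(3^N) = p^D, p the odd characteristic.
-- The elements x with x^Q = x form a set K closed under subtraction, by the Frobenius identity
-- (u - v)^Q = u^Q - v^Q, and |K| ≥ Q because every other element is a root of 1 + y + ⋯ + y^Q
-- (y = x^(Q-1)), a polynomial of degree Q(Q - 1). A nonzero d ∈ K has d^(Q-1) = 1, hence
-- d^((r-1)/2) = 1, so d is a square by Euler's criterion. Thus K is a clique of size Q in P_N,
-- and every graph on k ≤ Q vertices embeds into it.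
module Submission where

open import Defs
open import Data.Nat using (ℕ; _^_; _≤_)

open import Level using (0ℓ)
open import Function using (_∘_; id; Injective)
open import Data.Bool using (Bool; true; false)
open import Data.Empty using (⊥-elim)
open import Data.Product using (_×_; _,_; proj₁; proj₂; ∃)
open import Data.Sum using (_⊎_; inj₁; inj₂)
open import Relation.Nullary using (¬_; Dec; does; yes; no)
open import Relation.Nullary.Decidable using (decidable-stable)
open import Relation.Unary using (Pred; Decidable)
open import Relation.Unary.Properties using (∁?)
open import Relation.Binary.PropositionalEquality
open import Data.Nat.Base as ℕ using (zero; suc; _<_; z≤n; s≤s; _!; _%_; _/_)
import Data.Nat.Properties as ℕ
open import Data.Nat.Tactic.RingSolver using (solve-∀)
open import Data.Nat.Divisibility using (_∣_; divides; ∣⇒≤; m∣m*n)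
open import Data.Nat.DivMod using (m*[n/m]≡n; m≡m%n+[m/n]*n; %-distribˡ-*)
open import Data.Nat.Primality using (Prime; euclidsLemma; prime⇒nonTrivial)
open import Data.Nat.Combinatorics using (_C_; nCk≡n!/k![n-k]!; k![n∸k]!∣n!; nCn≡1)
open import Data.Fin.Base as Fin using (Fin; toℕ; inject≤)
import Data.Fin.Properties as Fin
open import Data.Fin.Permutation using (Permutation; permutation)
open import Data.Vec.Base using (Vec; []; _∷_; _++_; replicate)
open import Data.Vec.Functional using (removeAt)
open import Data.List.Base as List using (List; []; _∷_; length; lookup; filter; allFin; map)
import Data.List.Properties as List
open import Data.List.Relation.Unary.All as All using (All; []; _∷_)
open import Data.List.Relation.Unary.All.Properties using (all-filter)
open import Data.List.Relation.Unary.Any as Any using ()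
open import Data.List.Relation.Unary.Any.Properties using (lookup-index)
open import Data.List.Relation.Unary.AllPairs using (_∷_)
open import Data.List.Relation.Unary.Unique.Propositional using (Unique)
import Data.List.Relation.Unary.Unique.Propositional.Properties as Unique
open import Data.List.Membership.Propositional using (_∈_)
open import Data.List.Membership.Propositional.Properties
  using (∈-lookup; ∈-filter⁺; ∈-filter⁻; ∈-allFin; ∈-map⁺; ∈-++⁺ˡ; ∈-++⁺ʳ)
open import Algebra.Bundles using (CommutativeRing)
import Algebra.Solver.Ring.NaturalCoefficients.Default as SemiringSolver
import Algebra.Properties.Group as GroupProperties
import Algebra.Properties.Semiring.Exp as SemiringExp
import Algebra.Properties.CommutativeSemiring.Exp as CommutativeSemiringExp
import Algebra.Properties.Semiring.Mult as SemiringMult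
import Algebra.Properties.CommutativeMonoid.Sum as CommutativeMonoidSum
import Algebra.Properties.CommutativeSemiring.Binomial as Binomial

prime∤! : ∀ {p k} → Prime p → k < p → ¬ p ∣ k !
prime∤! {p} {zero} p-prime _ p∣1 =
  ℕ.<⇒≱ (ℕ.nonTrivial⇒n>1 p {{prime⇒nonTrivial p-prime}}) (∣⇒≤ p∣1)
prime∤! {p} {suc k} p-prime k<p p∣[1+k]! with euclidsLemma (suc k) (k !) p-prime p∣[1+k]!
... | inj₁ p∣1+k = ℕ.<⇒≱ k<p (∣⇒≤ p∣1+k)
... | inj₂ p∣k!  = prime∤! p-prime (ℕ.<-trans (ℕ.n<1+n k) k<p) p∣k!

nCk*k![n∸k]!≡n! : ∀ {n k} → k ≤ n → (n C k) ℕ.* (k ! ℕ.* (n ℕ.∸ k) !) ≡ n !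
nCk*k![n∸k]!≡n! {n} {k} k≤n = begin
  (n C k) ℕ.* k![n∸k]!           ≡⟨ ℕ.*-comm (n C k) k![n∸k]! ⟩
  k![n∸k]! ℕ.* (n C k)           ≡⟨ cong (k![n∸k]! ℕ.*_) (nCk≡n!/k![n-k]! k≤n) ⟩
  k![n∸k]! ℕ.* (n ! / k![n∸k]!)  ≡⟨ m*[n/m]≡n (k![n∸k]!∣n! k≤n) ⟩
  n !                            ∎
  where
  open ≡-Reasoning
  k![n∸k]! : ℕ
  k![n∸k]! = k ! ℕ.* (n ℕ.∸ k) !
  instance _ = ℕ._!*_!≢0 k (n ℕ.∸ k)

prime∣binomial : ∀ {p k} → Prime p → 0 < k → k < p → p ∣ p C k
prime∣binomial {suc p′} {k} p-prime 0<k k<p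
  with euclidsLemma (suc p′ C k) (k ! ℕ.* (suc p′ ℕ.∸ k) !) p-prime
         (subst (suc p′ ∣_) (sym (nCk*k![n∸k]!≡n! (ℕ.<⇒≤ k<p))) (m∣m*n (p′ !)))
... | inj₁ p∣pCk       = p∣pCk
... | inj₂ p∣k![p∸k]! with euclidsLemma (k !) ((suc p′ ℕ.∸ k) !) p-prime p∣k![p∸k]!
...   | inj₁ p∣k!     = ⊥-elim (prime∤! p-prime k<p p∣k!)
...   | inj₂ p∣[p∸k]! = ⊥-elim (prime∤! p-prime (ℕ.∸-monoʳ-< 0<k (ℕ.<⇒≤ k<p)) p∣[p∸k]!)

n%2≡1⇒n≡1+2[n/2] : ∀ n → n % 2 ≡ 1 → n ≡ suc (2 ℕ.* (n / 2))
n%2≡1⇒n≡1+2[n/2] n n%2≡1 = trans (m≡m%n+[m/n]*n n 2) (cong₂ ℕ._+_ n%2≡1 (ℕ.*-comm (n / 2) 2))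

^-odd : ∀ n e → n % 2 ≡ 1 → n ^ e % 2 ≡ 1
^-odd n zero    n%2≡1 = refl
^-odd n (suc e) n%2≡1 =
  trans (%-distribˡ-* n (n ^ e) 2) (cong₂ (λ a b → (a ℕ.* b) % 2) n%2≡1 (^-odd n e n%2≡1))

[m^2]^n≡m^n*m^n : ∀ m n → (m ^ 2) ^ n ≡ m ^ n ℕ.* m ^ n
[m^2]^n≡m^n*m^n m n = begin
  (m ^ 2) ^ n           ≡⟨ ℕ.^-*-assoc m 2 n ⟩
  m ^ (n ℕ.+ (n ℕ.+ 0)) ≡⟨ cong (λ e → m ^ (n ℕ.+ e)) (ℕ.+-identityʳ n) ⟩
  m ^ (n ℕ.+ n)         ≡⟨ ℕ.^-distribˡ-+-* m n n ⟩
  m ^ n ℕ.* m ^ n       ∎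
  where open ≡-Reasoning

Unique⇒lookup-injective : ∀ {A : Set} {xs : List A} → Unique xs → Injective _≡_ _≡_ (lookup xs)
Unique⇒lookup-injective (_ ∷ _)          {Fin.zero}  {Fin.zero}  _      = refl
Unique⇒lookup-injective (x∉xs ∷ _)       {Fin.zero}  {Fin.suc j} x≡xsⱼ  =
  ⊥-elim (All.lookup x∉xs (∈-lookup j) x≡xsⱼ)
Unique⇒lookup-injective (x∉xs ∷ _)       {Fin.suc i} {Fin.zero}  xsᵢ≡x  =
  ⊥-elim (All.lookup x∉xs (∈-lookup i) (sym xsᵢ≡x))
Unique⇒lookup-injective (_ ∷ xs-unique) {Fin.suc i} {Fin.suc j} xsᵢ≡xsⱼ =
  cong Fin.suc (Unique⇒lookup-injective xs-unique xsᵢ≡xsⱼ)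

injective⇒≤length : ∀ {B : Set} {n} {ys : List B} (f : Fin n → B) →
                    Injective _≡_ _≡_ f → (∀ i → f i ∈ ys) → n ≤ length ys
injective⇒≤length {ys = ys} f f-injective f∈ys = Fin.injective⇒≤ index-injective
  where
  index-injective : Injective _≡_ _≡_ (λ i → Any.index (f∈ys i))
  index-injective {i} {j} indexᵢ≡indexⱼ = f-injective (begin
    f i                            ≡⟨ lookup-index (f∈ys i) ⟩
    lookup ys (Any.index (f∈ys i)) ≡⟨ cong (lookup ys) indexᵢ≡indexⱼ ⟩
    lookup ys (Any.index (f∈ys j)) ≡⟨ lookup-index (f∈ys j) ⟨
    f j                            ∎)
    where open ≡-Reasoning

length-filter+length-filter-∁ : ∀ {A : Set} {P : Pred A 0ℓ} (P? : Decidable P) xs →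
                                length (filter P? xs) ℕ.+ length (filter (∁? P?) xs) ≡ length xs
length-filter+length-filter-∁ P? []       = refl
length-filter+length-filter-∁ P? (x ∷ xs) with P? x
... | yes _ = cong suc (length-filter+length-filter-∁ P? xs)
... | no  _ = trans (ℕ.+-suc _ _) (cong suc (length-filter+length-filter-∁ P? xs))

module FiniteFieldProperties {r : ℕ} (F : FiniteField r) where

  open FiniteField F using (isCommutativeRing; 0≢1; inverse)

  commutativeRing : CommutativeRing 0ℓ 0ℓ
  commutativeRing = record { isCommutativeRing = isCommutativeRing }

  open CommutativeRing commutativeRing
    using ( _+_; _*_; -_; _-_; 0#; 1#; +-comm; +-identityˡ; +-identityʳ; -‿inverseˡ; -‿inverseʳ
          ; *-assoc; *-comm; *-identityˡ; *-identityʳ; distribʳ; zeroˡ; zeroʳ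
          ; semiring; commutativeSemiring; +-group; +-commutativeMonoid; *-commutativeMonoid )
  open GroupProperties +-group
    using ( x∙y⁻¹≈ε⇒x≈y; x≈y⇒x∙y⁻¹≈ε; identityˡ-unique; identityʳ-unique; inverseʳ-unique
          ; ε⁻¹≈ε; ⁻¹-involutive; //-rightDividesˡ; //-rightDividesʳ; x≈z//y; ∙-cancelʳ )
  open SemiringExp semiring using (^-assocʳ; ^-homo-*) renaming (_^_ to _**_)
  open CommutativeSemiringExp commutativeSemiring using (^-distrib-*)
  open SemiringMult semiring using (×1-homo-*; ×-assoc-*; ×-homo-1) renaming (_×_ to _•_)
  open SemiringSolver commutativeSemiring using (solve; _:=_; _:+_; _:*_; con)
  module Σ = CommutativeMonoidSum +-commutativeMonoid
  module Π = CommutativeMonoidSum *-commutativeMonoid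

  ∑ ∏ : (Fin r → Fin r) → Fin r
  ∑ = Σ.sum
  ∏ = Π.sum

  1<r : 1 < r
  1<r = ℕ.≰⇒> λ r≤1 → 0≢1 (Fin.toℕ-injective (trans (toℕ≡0 r≤1 0#) (sym (toℕ≡0 r≤1 1#))))
    where
    toℕ≡0 : r ≤ 1 → (x : Fin r) → toℕ x ≡ 0
    toℕ≡0 r≤1 x = ℕ.n<1⇒n≡0 (ℕ.<-≤-trans (Fin.toℕ<n x) r≤1)

  module _ {x} (x≢0 : x ≢ 0#) where

    private
      x⁻¹ : Fin r
      x⁻¹ = proj₁ (inverse x x≢0)

      x*x⁻¹≡1 : x * x⁻¹ ≡ 1#
      x*x⁻¹≡1 = proj₂ (inverse x x≢0)

      x*[x⁻¹*y]≡y : ∀ y → x * (x⁻¹ * y) ≡ y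
      x*[x⁻¹*y]≡y y = trans (sym (*-assoc x x⁻¹ y)) (trans (cong (_* y) x*x⁻¹≡1) (*-identityˡ y))

      x⁻¹*[x*y]≡y : ∀ y → x⁻¹ * (x * y) ≡ y
      x⁻¹*[x*y]≡y y =
        trans (sym (*-assoc x⁻¹ x y)) (trans (cong (_* y) (trans (*-comm x⁻¹ x) x*x⁻¹≡1)) (*-identityˡ y))

    *-cancelˡ : ∀ {y z} → x * y ≡ x * z → y ≡ z
    *-cancelˡ {y} {z} xy≡xz = trans (sym (x⁻¹*[x*y]≡y y)) (trans (cong (x⁻¹ *_) xy≡xz) (x⁻¹*[x*y]≡y z))

    scaling : Permutation r r
    scaling = permutation (x *_) (x⁻¹ *_) x*[x⁻¹*y]≡y x⁻¹*[x*y]≡y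

  *-≢0 : ∀ {x y} → x ≢ 0# → y ≢ 0# → x * y ≢ 0#
  *-≢0 x≢0 y≢0 xy≡0 = y≢0 (*-cancelˡ x≢0 (trans xy≡0 (sym (zeroʳ _))))

  ^-≢0 : ∀ {x} n → x ≢ 0# → x ** n ≢ 0#
  ^-≢0 zero    _   = 0≢1 ∘ sym
  ^-≢0 (suc n) x≢0 = *-≢0 x≢0 (^-≢0 n x≢0)

  1**n≡1 : ∀ n → 1# ** n ≡ 1#
  1**n≡1 zero    = refl
  1**n≡1 (suc n) = trans (*-identityˡ _) (1**n≡1 n)

  -- Characteristic and the Frobenius map

  n•x≡n•1*x : ∀ n x → n • x ≡ (n • 1#) * x
  n•x≡n•1*x n x = trans (cong (n •_) (sym (*-identityˡ x))) (sym (×-assoc-* n 1# x))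

  r•x≡0 : ∀ x → r • x ≡ 0#
  r•x≡0 x = identityʳ-unique (∑ id) (r • x) (sym ∑id≡∑id+r•x)
    where
    translation : Permutation r r
    translation = permutation (_+ x) (_- x) (//-rightDividesˡ x) (//-rightDividesʳ x)
    ∑id≡∑id+r•x : ∑ id ≡ ∑ id + r • x
    ∑id≡∑id+r•x = begin
      ∑ id                ≡⟨ Σ.sum-permute id translation ⟩
      ∑ (_+ x)            ≡⟨ Σ.∑-distrib-+ id (λ _ → x) ⟩
      ∑ id + ∑ (λ _ → x)  ≡⟨ cong (∑ id +_) (Σ.sum-replicate r) ⟩
      ∑ id + r • x        ∎
      where open ≡-Reasoning

  [p^n]•1≡[p•1]**n : ∀ p n → (p ^ n) • 1# ≡ (p • 1#) ** n
  [p^n]•1≡[p•1]**n p zero    = ×-homo-1 1#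
  [p^n]•1≡[p•1]**n p (suc n) =
    trans (×1-homo-* p (p ^ n)) (cong ((p • 1#) *_) ([p^n]•1≡[p•1]**n p n))

  r≡p^n⇒p•1≡0 : ∀ p n → r ≡ p ^ n → p • 1# ≡ 0#
  r≡p^n⇒p•1≡0 p zero    r≡1   = ⊥-elim (ℕ.<-irrefl (sym r≡1) 1<r)
  r≡p^n⇒p•1≡0 p (suc n) r≡p^n = decidable-stable (p • 1# Fin.≟ 0#) λ p•1≢0 →
    ^-≢0 (suc n) p•1≢0 (begin
      (p • 1#) ** suc n ≡⟨ [p^n]•1≡[p•1]**n p (suc n) ⟨
      (p ^ suc n) • 1#  ≡⟨ cong (_• 1#) r≡p^n ⟨
      r • 1#            ≡⟨ r•x≡0 1# ⟩
      0#                ∎)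
    where open ≡-Reasoning

  p•1≡0⇒1+1≢0 : ∀ p → p % 2 ≡ 1 → p • 1# ≡ 0# → 1# + 1# ≢ 0#
  p•1≡0⇒1+1≢0 p p-odd p•1≡0 1+1≡0 = 0≢1 (sym (begin
    1#                        ≡⟨ +-identityʳ 1# ⟨
    1# + 0#                   ≡⟨ cong (1# +_) (zeroˡ (u • 1#)) ⟨
    1# + 0# * (u • 1#)        ≡⟨ cong (λ c → 1# + c * (u • 1#)) 2•1≡0 ⟨
    1# + (2 • 1#) * (u • 1#)  ≡⟨ cong (1# +_) (×1-homo-* 2 u) ⟨
    suc (2 ℕ.* u) • 1#        ≡⟨ cong (_• 1#) (n%2≡1⇒n≡1+2[n/2] p p-odd) ⟨
    p • 1#                    ≡⟨ p•1≡0 ⟩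
    0#                        ∎))
    where
    open ≡-Reasoning
    u : ℕ
    u = p / 2
    2•1≡0 : 2 • 1# ≡ 0#
    2•1≡0 = trans (cong (1# +_) (+-identityʳ 1#)) 1+1≡0

  p∣n⇒n•x≡0 : ∀ {p n} → p • 1# ≡ 0# → p ∣ n → ∀ x → n • x ≡ 0#
  p∣n⇒n•x≡0 {p} p•1≡0 (divides m refl) x = begin
    (m ℕ.* p) • x              ≡⟨ n•x≡n•1*x (m ℕ.* p) x ⟩
    ((m ℕ.* p) • 1#) * x       ≡⟨ cong (_* x) (×1-homo-* m p) ⟩
    ((m • 1#) * (p • 1#)) * x  ≡⟨ cong (λ c → ((m • 1#) * c) * x) p•1≡0 ⟩
    ((m • 1#) * 0#) * x        ≡⟨ cong (_* x) (zeroʳ _) ⟩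
    0# * x                     ≡⟨ zeroˡ x ⟩
    0#                         ∎
    where open ≡-Reasoning

  ^p-homo-+ : ∀ {p} → Prime p → p • 1# ≡ 0# → ∀ x y → (x + y) ** p ≡ x ** p + y ** p
  ^p-homo-+ {suc p′} p-prime p•1≡0 x y = begin
    (x + y) ** p                                         ≡⟨ theorem p x y ⟩
    term Fin.zero + Σ.sum (term ∘ Fin.suc)               ≡⟨ cong (term Fin.zero +_)
                                                                 (Σ.sum-init-last (term ∘ Fin.suc)) ⟩
    term Fin.zero + (Σ.sum middle + term (Fin.fromℕ p))  ≡⟨ cong₂ (λ a b → a + (b + term (Fin.fromℕ p)))
                                                                  firstTerm middle≡0 ⟩
    y ** p + (0# + term (Fin.fromℕ p))                   ≡⟨ cong (y ** p +_)
                                                                 (trans (+-identityˡ _) lastTerm) ⟩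
    y ** p + x ** p                                      ≡⟨ +-comm (y ** p) (x ** p) ⟩
    x ** p + y ** p                                      ∎
    where
    open ≡-Reasoning
    open Binomial commutativeSemiring using (theorem; binomialTerm)
    p : ℕ
    p = suc p′
    term : Fin (suc p) → Fin r
    term = binomialTerm x y p
    termℕ : ℕ → Fin r
    termℕ k = (p C k) • (x ** k * y ** (p ℕ.∸ k))
    middle : Fin p′ → Fin r
    middle = term ∘ Fin.suc ∘ Fin.inject₁
    firstTerm : term Fin.zero ≡ y ** p
    firstTerm = trans (×-homo-1 (1# * y ** p)) (*-identityˡ (y ** p))
    lastTerm : term (Fin.fromℕ p) ≡ x ** p
    lastTerm = begin
      termℕ (toℕ (Fin.fromℕ p))            ≡⟨ cong termℕ (Fin.toℕ-fromℕ p) ⟩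
      (p C p) • (x ** p * y ** (p ℕ.∸ p))  ≡⟨ cong₂ (λ c n → c • (x ** p * y ** n))
                                                     (nCn≡1 p) (ℕ.n∸n≡0 p) ⟩
      1 • (x ** p * 1#)                    ≡⟨ ×-homo-1 _ ⟩
      x ** p * 1#                          ≡⟨ *-identityʳ (x ** p) ⟩
      x ** p                               ∎
    middle≡0 : Σ.sum middle ≡ 0#
    middle≡0 = trans (Σ.sum-cong-≗ λ i →
                        p∣n⇒n•x≡0 p•1≡0 (prime∣binomial p-prime (s≤s z≤n) (s≤s (Fin.inject₁ℕ< i))) _)
                     (Σ.sum-replicate-zero p′)

  ^p^n-homo-+ : ∀ {p} → Prime p → p • 1# ≡ 0# →
                ∀ n x y → (x + y) ** (p ^ n) ≡ x ** (p ^ n) + y ** (p ^ n)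
  ^p^n-homo-+ p-prime p•1≡0 zero x y =
    trans (*-identityʳ (x + y)) (sym (cong₂ _+_ (*-identityʳ x) (*-identityʳ y)))
  ^p^n-homo-+ {p} p-prime p•1≡0 (suc n) x y = begin
    (x + y) ** (p ℕ.* p ^ n)                   ≡⟨ ^-assocʳ (x + y) p (p ^ n) ⟨
    ((x + y) ** p) ** (p ^ n)                  ≡⟨ cong (_** (p ^ n)) (^p-homo-+ p-prime p•1≡0 x y) ⟩
    (x ** p + y ** p) ** (p ^ n)               ≡⟨ ^p^n-homo-+ p-prime p•1≡0 n (x ** p) (y ** p) ⟩
    (x ** p) ** (p ^ n) + (y ** p) ** (p ^ n)  ≡⟨ cong₂ _+_ (^-assocʳ x p (p ^ n)) (^-assocʳ y p (p ^ n)) ⟩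
    x ** (p ℕ.* p ^ n) + y ** (p ℕ.* p ^ n)    ∎
    where open ≡-Reasoning

  ^p^n-homo-- : ∀ {p} → Prime p → p • 1# ≡ 0# →
                ∀ n x y → (x - y) ** (p ^ n) ≡ x ** (p ^ n) - y ** (p ^ n)
  ^p^n-homo-- {p} p-prime p•1≡0 n x y = x≈z//y _ _ _ (begin
    (x - y) ** (p ^ n) + y ** (p ^ n)  ≡⟨ ^p^n-homo-+ p-prime p•1≡0 n (x - y) y ⟨
    (x - y + y) ** (p ^ n)             ≡⟨ cong (_** (p ^ n)) (//-rightDividesˡ y x) ⟩
    x ** (p ^ n)                       ∎)
    where open ≡-Reasoning

  -- Fermat's little theorem

  ∏-≢0 : ∀ {m} (f : Fin m → Fin r) → (∀ i → f i ≢ 0#) → Π.sum f ≢ 0#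
  ∏-≢0 {zero}  f f≢0 = 0≢1 ∘ sym
  ∏-≢0 {suc m} f f≢0 = *-≢0 (f≢0 Fin.zero) (∏-≢0 (f ∘ Fin.suc) (f≢0 ∘ Fin.suc))

  ∏-const-except-at : ∀ {m} (f : Fin m → Fin r) i {x} →
                      f i ≡ 1# → (∀ j → j ≢ i → f j ≡ x) → Π.sum f * x ≡ x ** m
  ∏-const-except-at {suc m} f i {x} fᵢ≡1 fⱼ≡x = begin
    Π.sum f * x                        ≡⟨ cong (_* x) (Π.sum-remove f) ⟩
    (f i * Π.sum (removeAt f i)) * x   ≡⟨ cong (λ c → (c * Π.sum (removeAt f i)) * x) fᵢ≡1 ⟩
    (1# * Π.sum (removeAt f i)) * x    ≡⟨ cong (_* x) (*-identityˡ _) ⟩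
    Π.sum (removeAt f i) * x           ≡⟨ cong (_* x) (Π.sum-cong-≗ λ j → fⱼ≡x _ (Fin.punchInᵢ≢i i j)) ⟩
    Π.sum {m} (λ _ → x) * x            ≡⟨ cong (_* x) (Π.sum-replicate m) ⟩
    x ** m * x                         ≡⟨ *-comm (x ** m) x ⟩
    x ** suc m                         ∎
    where open ≡-Reasoning

  -- a ↦ x * a permutes Fin r. With 0 replaced by 1 the product of all elements is nonzero, and
  -- comparing it with the permuted product gives x^r = x.
  private
    nonzeroOr1 : Fin r → Fin r
    nonzeroOr1 a with a Fin.≟ 0#
    ... | yes _ = 1#
    ... | no  _ = a

    scaleFactor : Fin r → Fin r → Fin r
    scaleFactor x a with a Fin.≟ 0#
    ... | yes _ = 1#
    ... | no  _ = x

    nonzeroOr1≢0 : ∀ a → nonzeroOr1 a ≢ 0#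
    nonzeroOr1≢0 a with a Fin.≟ 0#
    ... | yes _   = 0≢1 ∘ sym
    ... | no  a≢0 = a≢0

    nonzeroOr1-* : ∀ {x} → x ≢ 0# → ∀ a → nonzeroOr1 (x * a) ≡ scaleFactor x a * nonzeroOr1 a
    nonzeroOr1-* {x} x≢0 a with a Fin.≟ 0# | x * a Fin.≟ 0#
    ... | yes _   | yes _    = sym (*-identityˡ 1#)
    ... | yes a≡0 | no  xa≢0 = ⊥-elim (xa≢0 (trans (cong (x *_) a≡0) (zeroʳ x)))
    ... | no  a≢0 | yes xa≡0 = ⊥-elim (*-≢0 x≢0 a≢0 xa≡0)
    ... | no  _   | no  _    = refl

    scaleFactor-0 : ∀ x → scaleFactor x 0# ≡ 1#
    scaleFactor-0 x with 0# Fin.≟ 0#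
    ... | yes _   = refl
    ... | no  0≢0 = ⊥-elim (0≢0 refl)

    scaleFactor-≢0 : ∀ x a → a ≢ 0# → scaleFactor x a ≡ x
    scaleFactor-≢0 x a a≢0 with a Fin.≟ 0#
    ... | yes a≡0 = ⊥-elim (a≢0 a≡0)
    ... | no  _   = refl

  x**r≡x : ∀ {x} → x ≢ 0# → x ** r ≡ x
  x**r≡x {x} x≢0 = *-cancelˡ (∏-≢0 nonzeroOr1 nonzeroOr1≢0) (begin
    P * x ** r         ≡⟨ cong (P *_) (∏-const-except-at E 0# (scaleFactor-0 x) (scaleFactor-≢0 x)) ⟨
    P * (∏ E * x)      ≡⟨ solve 3 (λ P E x → P :* (E :* x) := x :* (E :* P)) refl P (∏ E) x ⟩
    x * (∏ E * P)      ≡⟨ cong (x *_) P≡∏E*P ⟨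
    x * P              ≡⟨ *-comm x P ⟩
    P * x              ∎)
    where
    open ≡-Reasoning
    P : Fin r
    P = ∏ nonzeroOr1
    E : Fin r → Fin r
    E = scaleFactor x
    P≡∏E*P : P ≡ ∏ E * P
    P≡∏E*P = begin
      P                                ≡⟨ Π.sum-permute nonzeroOr1 (scaling x≢0) ⟩
      ∏ (nonzeroOr1 ∘ (x *_))          ≡⟨ Π.sum-cong-≗ (nonzeroOr1-* x≢0) ⟩
      ∏ (λ a → E a * nonzeroOr1 a)     ≡⟨ Π.∑-distrib-+ E nonzeroOr1 ⟩
      ∏ E * P                          ∎

  fermat : ∀ {n x} → r ≡ suc n → x ≢ 0# → x ** n ≡ 1#
  fermat {n} {x} r≡1+n x≢0 = *-cancelˡ x≢0 (begin
    x * x ** n  ≡⟨ cong (x **_) r≡1+n ⟨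
    x ** r      ≡⟨ x**r≡x x≢0 ⟩
    x           ≡⟨ *-identityʳ x ⟨
    x * 1#      ∎)
    where open ≡-Reasoning

  -- Monic polynomials and their roots

  -- c₀ ∷ ⋯ ∷ c_{d-1} stands for the monic polynomial c₀ + c₁X + ⋯ + c_{d-1}X^{d-1} + X^d.
  evalMonic : ∀ {d} → Vec (Fin r) d → Fin r → Fin r
  evalMonic []       x = 1#
  evalMonic (c ∷ cs) x = c + x * evalMonic cs x

  divideBy : ∀ {d} → Fin r → Vec (Fin r) (suc d) → Vec (Fin r) d
  divideBy a (c ∷ [])         = []
  divideBy a (c ∷ cs@(_ ∷ _)) = evalMonic cs a ∷ divideBy a cs

  evalMonic-divideBy : ∀ {d} a (cs : Vec (Fin r) (suc d)) x →
                       evalMonic cs x ≡ (x - a) * evalMonic (divideBy a cs) x + evalMonic cs a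
  evalMonic-divideBy a cs x =
    subst (λ x′ → evalMonic cs x′ ≡ (x - a) * evalMonic (divideBy a cs) x′ + evalMonic cs a)
          (//-rightDividesˡ a x) (at-u+a cs (x - a))
    where
    -- Evaluating at u + a rather than at x keeps subtraction out, so the semiring solver applies.
    at-u+a : ∀ {d} (cs : Vec (Fin r) (suc d)) u →
             evalMonic cs (u + a) ≡ u * evalMonic (divideBy a cs) (u + a) + evalMonic cs a
    at-u+a (c ∷ []) u =
      solve 4 (λ c u a one → c :+ (u :+ a) :* one := u :* one :+ (c :+ a :* one)) refl c u a 1#
    at-u+a (c ∷ cs@(_ ∷ _)) u = begin
      c + (u + a) * evalMonic cs (u + a)     ≡⟨ cong (λ e → c + (u + a) * e) (at-u+a cs u) ⟩
      c + (u + a) * (u * q + evalMonic cs a) ≡⟨ solve 5 (λ c u a q e → c :+ (u :+ a) :* (u :* q :+ e)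
                                                                 := u :* (e :+ (u :+ a) :* q) :+ (c :+ a :* e))
                                                        refl c u a q (evalMonic cs a) ⟩
      u * (evalMonic cs a + (u + a) * q) + (c + a * evalMonic cs a) ∎
      where
      open ≡-Reasoning
      q : Fin r
      q = evalMonic (divideBy a cs) (u + a)

  divideBy-root : ∀ {d a b} (cs : Vec (Fin r) (suc d)) →
                  evalMonic cs a ≡ 0# → a ≢ b → evalMonic cs b ≡ 0# → evalMonic (divideBy a cs) b ≡ 0#
  divideBy-root {a = a} {b} cs a-root a≢b b-root = *-cancelˡ b-a≢0 (begin
    (b - a) * q                   ≡⟨ +-identityʳ _ ⟨
    (b - a) * q + 0#              ≡⟨ cong ((b - a) * q +_) a-root ⟨
    (b - a) * q + evalMonic cs a  ≡⟨ evalMonic-divideBy a cs b ⟨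
    evalMonic cs b                ≡⟨ b-root ⟩
    0#                            ≡⟨ zeroʳ (b - a) ⟨
    (b - a) * 0#                  ∎)
    where
    open ≡-Reasoning
    q : Fin r
    q = evalMonic (divideBy a cs) b
    b-a≢0 : b - a ≢ 0#
    b-a≢0 = a≢b ∘ sym ∘ x∙y⁻¹≈ε⇒x≈y b a

  roots≤degree : ∀ {d} (cs : Vec (Fin r) d) {xs} →
                 Unique xs → All (λ a → evalMonic cs a ≡ 0#) xs → length xs ≤ d
  roots≤degree cs       {[]}     _                  _                   = z≤n
  roots≤degree []       {_ ∷ _}  _                  (1≡0 ∷ _)           = ⊥-elim (0≢1 (sym 1≡0))
  roots≤degree (c ∷ cs) {a ∷ as} (a∉as ∷ as-unique) (a-root ∷ as-roots) =
    s≤s (roots≤degree (divideBy a (c ∷ cs)) as-unique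
           (All.zipWith (λ (a≢b , b-root) → divideBy-root (c ∷ cs) a-root a≢b b-root) (a∉as , as-roots)))

  r≤length-filter+degree : ∀ {P : Pred (Fin r) 0ℓ} (P? : Decidable P) {d} (cs : Vec (Fin r) d) →
                           (∀ x → ¬ P x → evalMonic cs x ≡ 0#) → r ≤ length (filter P? (allFin r)) ℕ.+ d
  r≤length-filter+degree P? {d} cs ¬P⇒root = begin
    r                                                 ≡⟨ List.length-tabulate id ⟨
    length (allFin r)                                 ≡⟨ length-filter+length-filter-∁ P? (allFin r) ⟨
    length Ps ℕ.+ length (filter (∁? P?) (allFin r))  ≤⟨ ℕ.+-monoʳ-≤ (length Ps) length-∁Ps≤d ⟩
    length Ps ℕ.+ d                                   ∎
    where
    open ℕ.≤-Reasoning
    Ps : List (Fin r)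
    Ps = filter P? (allFin r)
    length-∁Ps≤d : length (filter (∁? P?) (allFin r)) ≤ d
    length-∁Ps≤d = roots≤degree cs (Unique.filter⁺ (∁? P?) (Unique.allFin⁺ r))
                                   (All.map (λ {x} → ¬P⇒root x) (all-filter (∁? P?) (allFin r)))

  evalMonic-zeros : ∀ n x → evalMonic (replicate n 0#) x ≡ x ** n
  evalMonic-zeros zero    x = refl
  evalMonic-zeros (suc n) x = trans (+-identityˡ _) (cong (x *_) (evalMonic-zeros n x))

  evalMonic-zeros++ : ∀ n {d} (cs : Vec (Fin r) d) x →
                      evalMonic (replicate n 0# ++ cs) x ≡ x ** n * evalMonic cs x
  evalMonic-zeros++ zero    cs x = sym (*-identityˡ _)
  evalMonic-zeros++ (suc n) cs x =
    trans (+-identityˡ _) (trans (cong (x *_) (evalMonic-zeros++ n cs x)) (sym (*-assoc _ _ _)))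

  -- 1 + Y + ⋯ + Y^j with Y = X^(m+1).
  geometric : ∀ m j → Vec (Fin r) (j ℕ.* suc m)
  geometric m zero    = []
  geometric m (suc j) = (1# ∷ replicate m 0#) ++ geometric m j

  evalMonic-geometric : ∀ m j x → let y = x ** suc m; S = evalMonic (geometric m j) x in
                        y * S + 1# ≡ S + y ** suc j
  evalMonic-geometric m zero    x = +-comm _ 1#
  evalMonic-geometric m (suc j) x = begin
    y * S′ + 1#                    ≡⟨ cong (λ e → y * e + 1#) S′≡1+y*S ⟩
    y * (1# + y * S) + 1#          ≡⟨ solve 2 (λ y S → y :* (con 1 :+ y :* S) :+ con 1
                                                     := con 1 :+ y :* (y :* S :+ con 1)) refl y S ⟩
    1# + y * (y * S + 1#)          ≡⟨ cong (λ e → 1# + y * e) (evalMonic-geometric m j x) ⟩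
    1# + y * (S + y ** suc j)      ≡⟨ solve 3 (λ y S Y → con 1 :+ y :* (S :+ Y)
                                                       := (con 1 :+ y :* S) :+ y :* Y) refl y S (y ** suc j) ⟩
    (1# + y * S) + y * y ** suc j  ≡⟨ cong (_+ y ** suc (suc j)) S′≡1+y*S ⟨
    S′ + y ** suc (suc j)          ∎
    where
    open ≡-Reasoning
    y : Fin r
    y = x ** suc m
    S : Fin r
    S = evalMonic (geometric m j) x
    S′ : Fin r
    S′ = evalMonic (geometric m (suc j)) x
    S′≡1+y*S : S′ ≡ 1# + y * S
    S′≡1+y*S =
      cong (1# +_) (trans (cong (x *_) (evalMonic-zeros++ m (geometric m j) x)) (sym (*-assoc _ _ _)))

  -- The fixed points of x ↦ x^Q

  fixedPoints : ℕ → List (Fin r)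
  fixedPoints Q = filter (λ x → x ** Q Fin.≟ x) (allFin r)

  -- x^Q ≠ x forces x ≠ 0 and y = x^(Q-1) ≠ 1 with y^(Q+1) = x^(r-1) = 1, so 1 + y + ⋯ + y^Q = 0.
  nonFixedPoint⇒root : ∀ {m} → let Q = suc (suc m) in
                       r ≡ suc (suc m ℕ.* suc Q) → ∀ x → x ** Q ≢ x → evalMonic (geometric m Q) x ≡ 0#
  nonFixedPoint⇒root {m} r≡1+[Q-1][Q+1] x x^Q≢x =
    decidable-stable (S Fin.≟ 0#) λ S≢0 → y≢1 (*-cancelˡ S≢0 (begin
      S * y   ≡⟨ *-comm S y ⟩
      y * S   ≡⟨ ∙-cancelʳ 1# (y * S) S y*S+1≡S+1 ⟩
      S       ≡⟨ *-identityʳ S ⟨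
      S * 1#  ∎))
    where
    open ≡-Reasoning
    Q : ℕ
    Q = suc (suc m)
    y : Fin r
    y = x ** suc m
    S : Fin r
    S = evalMonic (geometric m Q) x
    x≢0 : x ≢ 0#
    x≢0 x≡0 = x^Q≢x (trans (cong (_** Q) x≡0) (trans (zeroˡ _) (sym x≡0)))
    y≢1 : y ≢ 1#
    y≢1 y≡1 = x^Q≢x (trans (cong (x *_) y≡1) (*-identityʳ x))
    y*S+1≡S+1 : y * S + 1# ≡ S + 1#
    y*S+1≡S+1 = trans (evalMonic-geometric m Q x)
                      (cong (S +_) (trans (^-assocʳ x (suc m) (suc Q)) (fermat r≡1+[Q-1][Q+1] x≢0)))

  Q≤length-fixedPoints : ∀ {Q} → r ≡ Q ℕ.* Q → Q ≤ length (fixedPoints Q)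
  Q≤length-fixedPoints {zero}        _     = z≤n
  Q≤length-fixedPoints {suc zero}    r≡1   = ⊥-elim (ℕ.<-irrefl (sym r≡1) 1<r)
  Q≤length-fixedPoints {suc (suc m)} r≡Q*Q = ℕ.+-cancelʳ-≤ (Q ℕ.* suc m) Q _ (begin
    Q ℕ.+ Q ℕ.* suc m                       ≡⟨ ℕ.*-suc Q (suc m) ⟨
    Q ℕ.* Q                                 ≡⟨ r≡Q*Q ⟨
    r                                       ≤⟨ r≤length-filter+degree _ (geometric m Q)
                                                 (nonFixedPoint⇒root {m} (trans r≡Q*Q (Q*Q≡1+[Q-1][Q+1] m))) ⟩
    length (fixedPoints Q) ℕ.+ Q ℕ.* suc m  ∎)
    where
    open ℕ.≤-Reasoning
    Q : ℕ
    Q = suc (suc m)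
    Q*Q≡1+[Q-1][Q+1] : ∀ m → suc (suc m) ℕ.* suc (suc m) ≡ suc (suc m ℕ.* suc (suc (suc m)))
    Q*Q≡1+[Q-1][Q+1] = solve-∀

  -- Squares and Euler's criterion

  IsSquare : Fin r → Set
  IsSquare w = ∃ λ y → y * y ≡ w

  isSquare? : Decidable IsSquare
  isSquare? w = Fin.any? λ y → y * y Fin.≟ w

  squares : List (Fin r)
  squares = filter isSquare? (allFin r)

  x*x≡y*y⇒x≡y⊎y≡-x : ∀ {x y} → x * x ≡ y * y → x ≡ y ⊎ y ≡ - x
  x*x≡y*y⇒x≡y⊎y≡-x {x} {y} xx≡yy with x - y Fin.≟ 0#
  ... | yes x-y≡0 = inj₁ (x∙y⁻¹≈ε⇒x≈y x y x-y≡0)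
  ... | no  x-y≢0 = inj₂ (inverseʳ-unique x y (*-cancelˡ x-y≢0 (trans [x-y][x+y]≡0 (sym (zeroʳ (x - y))))))
    where
    d : Fin r
    d = x - y
    [x-y][x+y]≡0 : (x - y) * (x + y) ≡ 0#
    [x-y][x+y]≡0 = identityˡ-unique _ (y * y) (begin
      d * (x + y) + y * y        ≡⟨ cong (λ e → d * (e + y) + y * y) (//-rightDividesˡ y x) ⟨
      d * ((d + y) + y) + y * y  ≡⟨ solve 2 (λ d y → d :* ((d :+ y) :+ y) :+ y :* y := (d :+ y) :* (d :+ y))
                                          refl d y ⟩
      (d + y) * (d + y)          ≡⟨ cong₂ _*_ (//-rightDividesˡ y x) (//-rightDividesˡ y x) ⟩
      x * x                      ≡⟨ xx≡yy ⟩
      y * y                      ∎)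
      where open ≡-Reasoning

  X[X^s-1] : ∀ s′ → Vec (Fin r) (suc (suc s′))
  X[X^s-1] s′ = 0# ∷ - 1# ∷ replicate s′ 0#

  X[X^s-1]-root : ∀ s′ {w} → w ≡ 0# ⊎ w ** suc s′ ≡ 1# → evalMonic (X[X^s-1] s′) w ≡ 0#
  X[X^s-1]-root s′ {w} w≡0⊎w^s≡1 = begin
    0# + w * (- 1# + w * evalMonic (replicate s′ 0#) w)  ≡⟨ +-identityˡ _ ⟩
    w * (- 1# + w * evalMonic (replicate s′ 0#) w)       ≡⟨ cong (λ e → w * (- 1# + w * e))
                                                                 (evalMonic-zeros s′ w) ⟩
    w * (- 1# + w ** suc s′)                             ≡⟨ vanishes w≡0⊎w^s≡1 ⟩
    0#                                                   ∎
    where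
    open ≡-Reasoning
    vanishes : w ≡ 0# ⊎ w ** suc s′ ≡ 1# → w * (- 1# + w ** suc s′) ≡ 0#
    vanishes (inj₁ w≡0)   = trans (cong (_* (- 1# + w ** suc s′)) w≡0) (zeroˡ _)
    vanishes (inj₂ w^s≡1) =
      trans (cong (λ e → w * (- 1# + e)) w^s≡1) (trans (cong (w *_) (-‿inverseˡ 1#)) (zeroʳ w))

  -- Any way of telling y from -y will do; on the carrier Fin r the order of toℕ provides one.
  sign : Fin r → Bool
  sign y = does (toℕ y ℕ.<? toℕ (- y))

  module _ (1+1≢0 : 1# + 1# ≢ 0#) where

    x≡-x⇒x≡0 : ∀ {x} → x ≡ - x → x ≡ 0#
    x≡-x⇒x≡0 {x} x≡-x = decidable-stable (x Fin.≟ 0#) λ x≢0 → *-≢0 1+1≢0 x≢0 (begin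
      (1# + 1#) * x    ≡⟨ distribʳ x 1# 1# ⟩
      1# * x + 1# * x  ≡⟨ cong₂ _+_ (*-identityˡ x) (*-identityˡ x) ⟩
      x + x            ≡⟨ cong (x +_) x≡-x ⟩
      x + - x          ≡⟨ -‿inverseʳ x ⟩
      0#               ∎)
      where open ≡-Reasoning

    sign-neg : ∀ {y} → y ≢ 0# → sign (- y) ≢ sign y
    sign-neg {y} y≢0 = signs-differ (toℕ y ℕ.<? toℕ (- y)) (toℕ (- y) ℕ.<? toℕ (- - y))
      where
      signs-differ : (y<-y? : Dec (toℕ y ℕ.< toℕ (- y))) (-y<--y? : Dec (toℕ (- y) ℕ.< toℕ (- - y))) →
                     does -y<--y? ≢ does y<-y?
      signs-differ (yes y<-y) (yes -y<--y) _ =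
        ℕ.<-asym y<-y (subst (λ z → toℕ (- y) ℕ.< toℕ z) (⁻¹-involutive y) -y<--y)
      signs-differ (no y≮-y) (no -y≮--y) _ =
        y≢0 (x≡-x⇒x≡0 (Fin.toℕ-injective (ℕ.≤-antisym (ℕ.≮⇒≥ -y≮y) (ℕ.≮⇒≥ y≮-y))))
        where
        -y≮y : ¬ toℕ (- y) ℕ.< toℕ y
        -y≮y = subst (λ z → ¬ toℕ (- y) ℕ.< toℕ z) (⁻¹-involutive y) -y≮--y
      signs-differ (yes _) (no _)  ()
      signs-differ (no _)  (yes _) ()

    squareAndSign-injective : Injective _≡_ _≡_ (λ y → y * y , sign y)
    squareAndSign-injective {a} {b} eq with x*x≡y*y⇒x≡y⊎y≡-x (cong proj₁ eq)
    ... | inj₁ a≡b  = a≡b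
    ... | inj₂ b≡-a with a Fin.≟ 0#
    ...   | yes a≡0 = trans a≡0 (sym (trans b≡-a (trans (cong -_ a≡0) ε⁻¹≈ε)))
    ...   | no  a≢0 = ⊥-elim (sign-neg a≢0 (trans (cong sign (sym b≡-a)) (sym (cong proj₂ eq))))

    r≤2*length-squares : r ≤ length squares ℕ.+ length squares
    r≤2*length-squares = subst (r ≤_) length-signedSquares
      (injective⇒≤length (λ y → y * y , sign y) squareAndSign-injective ∈signedSquares)
      where
      signedSquares : List (Fin r × Bool)
      signedSquares = map (_, true) squares List.++ map (_, false) squares
      length-signedSquares : length signedSquares ≡ length squares ℕ.+ length squares
      length-signedSquares = trans (List.length-++ (map (_, true) squares))
                                   (cong₂ ℕ._+_ (List.length-map _ squares) (List.length-map _ squares))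
      y*y∈squares : ∀ y → y * y ∈ squares
      y*y∈squares y = ∈-filter⁺ isSquare? (∈-allFin (y * y)) (y , refl)
      ∈signedSquares : ∀ y → (y * y , sign y) ∈ signedSquares
      ∈signedSquares y with sign y
      ... | true  = ∈-++⁺ˡ (∈-map⁺ (_, true) (y*y∈squares y))
      ... | false = ∈-++⁺ʳ (map (_, true) squares) (∈-map⁺ (_, false) (y*y∈squares y))

    -- There are at least s + 1 squares, 0 included, and all are roots of X(X^s - 1) of degree s + 1,
    -- so a nonsquare root would be one root too many.
    euler : ∀ {s z} → r ≡ suc (s ℕ.+ s) → z ≢ 0# → z ** s ≡ 1# → IsSquare z
    euler {zero} r≡1 _ _ = ⊥-elim (ℕ.<-irrefl (sym r≡1) 1<r)
    euler {s@(suc s′)} {z} r≡1+2s z≢0 z^s≡1 = decidable-stable (isSquare? z) λ z-nonsquare →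
      ℕ.<-irrefl refl (begin-strict
        s ℕ.+ s                            <⟨ ℕ.n<1+n _ ⟩
        suc (s ℕ.+ s)                      ≡⟨ r≡1+2s ⟨
        r                                  ≤⟨ r≤2*length-squares ⟩
        length squares ℕ.+ length squares  ≤⟨ ℕ.+-mono-≤ (length-squares≤s z-nonsquare)
                                                         (length-squares≤s z-nonsquare) ⟩
        s ℕ.+ s                            ∎)
      where
      open ℕ.≤-Reasoning
      square-root : ∀ {w} → IsSquare w → evalMonic (X[X^s-1] s′) w ≡ 0#
      square-root (y , refl) with y Fin.≟ 0#
      ... | yes y≡0 = X[X^s-1]-root s′ (inj₁ (trans (cong (_* y) y≡0) (zeroˡ y)))
      ... | no  y≢0 = X[X^s-1]-root s′ (inj₂ (trans (^-distrib-* y y s)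
                                               (trans (sym (^-homo-* y s s)) (fermat r≡1+2s y≢0))))
      length-squares≤s : ¬ IsSquare z → length squares ≤ s
      length-squares≤s z-nonsquare = ℕ.s≤s⁻¹ (roots≤degree (X[X^s-1] s′) {z ∷ squares}
        (All.map (λ w-square z≡w → z-nonsquare (subst IsSquare (sym z≡w) w-square)) squares-areSquares
           ∷ Unique.filter⁺ isSquare? (Unique.allFin⁺ r))
        (X[X^s-1]-root s′ (inj₂ z^s≡1) ∷ All.map square-root squares-areSquares))
        where
        squares-areSquares : All IsSquare squares
        squares-areSquares = all-filter isSquare? (allFin r)

  -- Paley cliques

  fixedPoint⇒square : ∀ Q {d} → 1# + 1# ≢ 0# → r ≡ Q ℕ.* Q → Q % 2 ≡ 1 →
                      d ≢ 0# → d ** Q ≡ d → IsSquare d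
  fixedPoint⇒square Q {d} 1+1≢0 r≡Q*Q Q-odd d≢0 d^Q≡d =
    euler 1+1≢0 {2 ℕ.* t ℕ.* suc t} r≡1+2s d≢0 (begin
    d ** (2 ℕ.* t ℕ.* suc t)   ≡⟨ ^-assocʳ d (2 ℕ.* t) (suc t) ⟨
    (d ** (2 ℕ.* t)) ** suc t  ≡⟨ cong (_** suc t) d^[Q-1]≡1 ⟩
    1# ** suc t                ≡⟨ 1**n≡1 (suc t) ⟩
    1#                         ∎)
    where
    open ≡-Reasoning
    t : ℕ
    t = Q / 2
    Q≡1+2t : Q ≡ suc (2 ℕ.* t)
    Q≡1+2t = n%2≡1⇒n≡1+2[n/2] Q Q-odd
    [1+2t]²≡1+2s : ∀ t → suc (2 ℕ.* t) ℕ.* suc (2 ℕ.* t) ≡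
                         suc (2 ℕ.* t ℕ.* suc t ℕ.+ 2 ℕ.* t ℕ.* suc t)
    [1+2t]²≡1+2s = solve-∀
    r≡1+2s : r ≡ suc (2 ℕ.* t ℕ.* suc t ℕ.+ 2 ℕ.* t ℕ.* suc t)
    r≡1+2s = trans r≡Q*Q (trans (cong (λ n → n ℕ.* n) Q≡1+2t) ([1+2t]²≡1+2s t))
    d^[Q-1]≡1 : d ** (2 ℕ.* t) ≡ 1#
    d^[Q-1]≡1 = *-cancelˡ d≢0 (begin
      d * d ** (2 ℕ.* t)  ≡⟨ cong (d **_) Q≡1+2t ⟨
      d ** Q              ≡⟨ d^Q≡d ⟩
      d                   ≡⟨ *-identityʳ d ⟨
      d * 1#              ∎)

  IsPaleyClique : List (Fin r) → Set
  IsPaleyClique xs = ∀ {u v} → u ∈ xs → v ∈ xs → u ≢ v → IsSquare (u - v)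

  fixedPoints-isPaleyClique : ∀ {p} D → Prime p → p % 2 ≡ 1 → r ≡ p ^ D ℕ.* p ^ D →
                              IsPaleyClique (fixedPoints (p ^ D))
  fixedPoints-isPaleyClique {p} D p-prime p-odd r≡Q*Q {u} {v} u∈ v∈ u≢v =
    fixedPoint⇒square (p ^ D) (p•1≡0⇒1+1≢0 p p-odd p•1≡0) r≡Q*Q (^-odd p D p-odd)
                      (u≢v ∘ x∙y⁻¹≈ε⇒x≈y u v) (begin
        (u - v) ** (p ^ D)           ≡⟨ ^p^n-homo-- p-prime p•1≡0 D u v ⟩
        u ** (p ^ D) - v ** (p ^ D)  ≡⟨ cong₂ _-_ (fixed u∈) (fixed v∈) ⟩
        u - v                        ∎)
    where
    open ≡-Reasoning
    p•1≡0 : p • 1# ≡ 0#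
    p•1≡0 = r≡p^n⇒p•1≡0 p (D ℕ.+ D) (trans r≡Q*Q (sym (ℕ.^-distribˡ-+-* p D D)))
    fixed : ∀ {x} → x ∈ fixedPoints (p ^ D) → x ** (p ^ D) ≡ x
    fixed = proj₂ ∘ ∈-filter⁻ (λ x → x ** (p ^ D) Fin.≟ x) {xs = allFin r}

  subgraphOfClique : ∀ {k xs} (G : Graph k) → Unique xs → IsPaleyClique xs → k ≤ length xs →
                     SubgraphOfPaley G F
  subgraphOfClique {k} {xs} G xs-unique xs-clique k≤|xs| = f , f-injective , f-adjacent
    where
    open Graph G using (Adj; irrefl)
    f : Fin k → Fin r
    f i = lookup xs (inject≤ i k≤|xs|)
    f-injective : Injective _≡_ _≡_ f
    f-injective = Fin.inject≤-injective k≤|xs| k≤|xs| _ _ ∘ Unique⇒lookup-injective xs-unique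
    f-adjacent : ∀ u v → Adj u v → PaleyAdj F (f u) (f v)
    f-adjacent u v uv = fu-fv≢0 , xs-clique (∈-lookup _) (∈-lookup _) (fu-fv≢0 ∘ x≈y⇒x∙y⁻¹≈ε)
      where
      fu-fv≢0 : f u - f v ≢ 0#
      fu-fv≢0 = irrefl ∘ (λ u≡v → subst (Adj u) (sym u≡v) uv) ∘ f-injective
              ∘ x∙y⁻¹≈ε⇒x≈y (f u) (f v)

  subgraphOfPaley : ∀ {p k} D → Prime p → p % 2 ≡ 1 → r ≡ p ^ D ℕ.* p ^ D →
                    (G : Graph k) → k ≤ p ^ D → SubgraphOfPaley G F
  subgraphOfPaley D p-prime p-odd r≡Q*Q G k≤Q =
    subgraphOfClique G (Unique.filter⁺ _ (Unique.allFin⁺ r)) (fixedPoints-isPaleyClique D p-prime p-odd r≡Q*Q)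
                     (ℕ.≤-trans k≤Q (Q≤length-fixedPoints r≡Q*Q))

theorem6p1 : (q : ℕ) → OddPrimePower q → (k : ℕ) → (G : Graph k) →
    (N : ℕ) → 1 ≤ N → k ≤ q ^ (3 ^ N) → iP≤ q G N
theorem6p1 q (p , e , p-prime , p-odd , _ , q≡p^e) k G N 1≤N k≤Q =
  N , 1≤N , ℕ.≤-refl , λ F →
    FiniteFieldProperties.subgraphOfPaley F D p-prime p-odd r≡Q*Q G (subst (k ≤_) Q≡p^D k≤Q)
  where
  D : ℕ
  D = e ℕ.* 3 ^ N
  Q≡p^D : q ^ (3 ^ N) ≡ p ^ D
  Q≡p^D = trans (cong (_^ (3 ^ N)) q≡p^e) (ℕ.^-*-assoc p e (3 ^ N))
  r≡Q*Q : (q ^ 2) ^ (3 ^ N) ≡ p ^ D ℕ.* p ^ D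
  r≡Q*Q = trans ([m^2]^n≡m^n*m^n q (3 ^ N)) (cong₂ ℕ._*_ Q≡p^D Q≡p^D)
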